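{- Let $G=\langle a,b\mid a^m=b^n=1,\ b^{ -1}ab=a^r\rangle$, where $r^n\equiv 1\pmod m$, be a non-abelian group all of whose Sylow subgroups are cyclic. Suppose further that $G$ is not a direct product of any two non-trivial subgroups. Then $o(a^ib^j)=o(b^j)=n$ for all $0\le i\le m$ and all $j$ with $\gcd(j,n)=1$.
   Context: $o(g)$ denotes the order of an element $g$. Here $a$ has order $m$, $b$ has order $n$, and $|G|=mn$. -}

module Defs where

open import Level using (Level; _⊔_)
open import Algebra.Bundles using (Group)
open import Data.Nat using (ℕ; zero; suc; _<_; _≤_; _^_)
open import Data.Nat.Divisibility using (_∣_)
open import Data.Nat.Primality using (Prime)
open import Data.Fin using (Fin)
open import Data.Product using (Σ; ∃; _×_; _,_)
open import Relation.Binary.PropositionalEquality using (_≡_)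
open import Relation.Nullary using (¬_)

module GroupTheory {c ℓ : Level} (G : Group c ℓ) where
  open Group G

  infixr 8 _^ᵍ_
  _^ᵍ_ : Carrier → ℕ → Carrier
  g ^ᵍ zero  = ε
  g ^ᵍ suc k = g ∙ (g ^ᵍ k)

  HasOrder : Carrier → ℕ → Set ℓ
  HasOrder g k = (0 < k) × (g ^ᵍ k ≈ ε) × (∀ j → 0 < j → j < k → ¬ (g ^ᵍ j ≈ ε))

  record HasCardinality (S : Carrier → Set (c ⊔ ℓ)) (N : ℕ) : Set (c ⊔ ℓ) where
    field
      enum      : Fin N → Carrier
      enum-in   : ∀ i → S (enum i)
      enum-inj  : ∀ i j → enum i ≈ enum j → i ≡ j
      enum-surj : ∀ x → S x → ∃ λ i → enum i ≈ x

  Whole : Carrier → Set (c ⊔ ℓ)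
  Whole _ = Level.Lift (c ⊔ ℓ) Data.Unit.⊤
    where import Data.Unit

  HasOrderG : ℕ → Set (c ⊔ ℓ)
  HasOrderG N = HasCardinality Whole N

  record IsSubgroup (H : Carrier → Set (c ⊔ ℓ)) : Set (c ⊔ ℓ) where
    field
      resp  : ∀ {x y} → x ≈ y → H x → H y
      ε∈    : H ε
      ∙∈    : ∀ {x y} → H x → H y → H (x ∙ y)
      ⁻¹∈   : ∀ {x} → H x → H (x ⁻¹)

  IsNormalSubgroup : (Carrier → Set (c ⊔ ℓ)) → Set (c ⊔ ℓ)
  IsNormalSubgroup H = IsSubgroup H × (∀ g x → H x → H ((g ⁻¹ ∙ x) ∙ g))

  IsCyclicSubgroup : (Carrier → Set (c ⊔ ℓ)) → Set (c ⊔ ℓ)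
  IsCyclicSubgroup H = ∃ λ g → H g × (∀ h → H h → ∃ λ k → h ≈ g ^ᵍ k)

  IsSylow : (N p : ℕ) → (Carrier → Set (c ⊔ ℓ)) → Set (c ⊔ ℓ)
  IsSylow N p H = IsSubgroup H ×
    (∃ λ e → HasCardinality H (p ^ e) × Level.Lift (c ⊔ ℓ) ((p ^ e ∣ N) × ¬ (p ^ suc e ∣ N)))

  AllSylowCyclic : ℕ → Set (Level.suc (c ⊔ ℓ))
  AllSylowCyclic N = ∀ p → Prime p → ∀ H → IsSylow N p H → IsCyclicSubgroup H

  IsAbelian : Set (c ⊔ ℓ)
  IsAbelian = ∀ x y → x ∙ y ≈ y ∙ x

  NonTrivial : (Carrier → Set (c ⊔ ℓ)) → Set (c ⊔ ℓ)
  NonTrivial H = ∃ λ h → H h × ¬ (h ≈ ε)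

  IsDirectProductOfNontrivial : Set (Level.suc (c ⊔ ℓ))
  IsDirectProductOfNontrivial =
    Σ (Carrier → Set (c ⊔ ℓ)) λ H → Σ (Carrier → Set (c ⊔ ℓ)) λ K →
      IsNormalSubgroup H × IsNormalSubgroup K ×
      NonTrivial H × NonTrivial K ×
      (∀ x → H x → K x → x ≈ ε) ×
      (∀ g → ∃ λ h → ∃ λ k → H h × K k × g ≈ h ∙ k)

-- Write t = r − 1, so that aˣ commutes with b exactly when m ∣ t·x. Since |G| = mn and every
-- element is some aⁱbʲ, the subgroups ⟨a⟩ and ⟨b⟩ meet trivially and every element is uniquely
-- bᵛaᵘ. A prime p dividing both m and n would make ⟨b^n′⟩⟨a^m′⟩ (m′, n′ the p′-parts of m, n)
-- a Sylow p-subgroup containing the independent elements a^(m/p) and b^(n/p) of order p, which a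
-- cyclic p-group cannot; so gcd(m, n) = 1. As (ba)ⁿ = a^(1+r+⋯+r^(n−1)) commutes with b, m divides
-- t(1 + r + ⋯ + r^(n−1)); with d = gcd(t, m) this forces gcd(d, m/d) = 1, and d ≠ 1 would make
-- G = ⟨b, aᵈ⟩ × ⟨a^(m/d)⟩ with a central second factor. Hence gcd(t, m) = 1. Finally (aⁱbʲ)ⁿ = aᶻ
-- commutes with bʲ, hence with b when gcd(j, n) = 1, so m ∣ tz, m ∣ z and (aⁱbʲ)ⁿ = 1; while
-- (aⁱbʲ)ᵏ = 1 forces bʲᵏ = 1 by uniqueness of the normal form, i.e. n ∣ k.
module Submission where

open import Defs
open import Algebra.Bundles using (Group)
open import Data.Nat
  using (ℕ; zero; suc; pred; _+_; _*_; _^_; _<_; _≤_; _%_; _/_;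
         NonZero; nonTrivial⇒n>1; >-nonZero; >-nonZero⁻¹; ≢-nonZero; ≢-nonZero⁻¹)
import Data.Nat.Base as ℕ
open import Data.Nat.Properties
open import Function.Base using (_∘_)
open import Data.Nat.Divisibility
open import Data.Nat.GCD using (gcd; gcd-GCD; module Bézout; gcd[m,n]∣m; gcd[m,n]∣n; gcd-greatest; gcd[m,n]≡0⇒n≡0)
open import Data.Nat.Coprimality as Coprimality using (Coprime; coprime-divisor; coprime-Bézout; coprime⇒gcd≡1; gcd≡1⇒coprime)
open import Data.Nat.Induction using (<-rec)
open import Data.Nat.Primality using (Prime; prime⇒irreducible; prime⇒nonZero; prime⇒nonTrivial; euclidsLemma)
open import Data.Nat.Primality.Factorisation using (PrimeFactorisation; factorise)
open import Data.Nat.ListAction using (product)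
open import Data.Nat.DivMod using (m≡m%n+[m/n]*n; m%n<n)
open import Data.Nat.Tactic.RingSolver using (solve-∀)
open import Data.Fin.Base using (Fin; punchOut; toℕ; fromℕ<; combine; remQuot)
import Data.Fin.Properties as Fin
open import Function.Definitions using (Injective)
open import Data.List.Base using ([]; _∷_)
open import Data.List.Relation.Unary.All using (_∷_)
open import Data.Product using (∃; ∃₂; _×_; _,_; proj₁; proj₂)
open import Data.Sum using (_⊎_; inj₁; inj₂)
open import Data.Empty using (⊥; ⊥-elim)
open import Relation.Nullary using (¬_; yes; no)
open import Relation.Binary.PropositionalEquality as ≡ using (_≡_; refl; cong)
open import Level using (Level; Lift; lift; _⊔_)

prime⇒¬∣⇒coprime : ∀ {p s} → Prime p → ¬ p ∣ s → Coprime s p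
prime⇒¬∣⇒coprime p-prime p∤s (d∣s , d∣p) with prime⇒irreducible p-prime d∣p
... | inj₁ d≡1 = d≡1
... | inj₂ refl = ⊥-elim (p∤s d∣s)

p-part : ∀ {p} .{{_ : ℕ.NonTrivial p}} → ∀ x .{{_ : NonZero x}} → ∃₂ λ k x′ → x ≡ p ^ k * x′ × ¬ p ∣ x′
p-part {p} x = <-rec P split x
  where
  P : ℕ → Set
  P x = .{{NonZero x}} → ∃₂ λ k x′ → x ≡ p ^ k * x′ × ¬ p ∣ x′
  split : ∀ x → (∀ {y} → y < x → P y) → P x
  split x rec with p ∣? x
  ... | no p∤x = 0 , x , ≡.sym (*-identityˡ x) , p∤x
  ... | yes (divides q refl)
    with k , x′ , q≡ , p∤x′ ← rec (m<m*n q p {{m*n≢0⇒m≢0 q}} (nonTrivial⇒n>1 p)) {{m*n≢0⇒m≢0 q}} =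
    suc k , x′ , ≡.trans (cong (_* p) q≡) (≡.trans (*-comm _ p) (≡.sym (*-assoc p (p ^ k) x′))) , p∤x′

∣p^[1+e]⇒≡⊎∣p^e : ∀ {p d} e → Prime p → d ∣ p ^ suc e → d ≡ p ^ suc e ⊎ d ∣ p ^ e
∣p^[1+e]⇒≡⊎∣p^e {p} {d} e p-prime d∣ with p ∣? d
... | no p∤d = inj₂ (coprime-divisor (prime⇒¬∣⇒coprime p-prime p∤d) d∣)
... | yes (divides d′ refl) = step e (*-cancelʳ-∣ p {{prime⇒nonZero p-prime}} (≡.subst (d′ * p ∣_) (*-comm p (p ^ e)) d∣))
  where
  step : ∀ e → d′ ∣ p ^ e → d′ * p ≡ p ^ suc e ⊎ d′ * p ∣ p ^ e
  step zero d′∣1 rewrite ∣1⇒≡1 d′∣1 = inj₁ (*-comm 1 p)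
  step (suc e) d′∣ with ∣p^[1+e]⇒≡⊎∣p^e e p-prime d′∣
  ... | inj₁ refl = inj₁ (*-comm (p ^ suc e) p)
  ... | inj₂ d′∣p^e = inj₂ (≡.subst (d′ * p ∣_) (*-comm (p ^ e) p) (*-monoˡ-∣ p d′∣p^e))

no-common-prime⇒coprime : ∀ {m n} .{{_ : NonZero m}} → (∀ {p} → Prime p → p ∣ m → p ∣ n → ⊥) → Coprime m n
no-common-prime⇒coprime noCommon {d} (d∣m@(divides q refl) , d∣n) = go (factorise d {{m*n≢0⇒n≢0 q}})
  where
  go : PrimeFactorisation d → d ≡ 1
  go record { factors = [] ; isFactorisation = d≡1 } = d≡1
  go record { factors = p ∷ ps ; isFactorisation = d≡ ; factorsPrime = p-prime ∷ _ } =
    ⊥-elim (noCommon p-prime (∣-trans p∣d d∣m) (∣-trans p∣d d∣n))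
    where
    p∣d : p ∣ d
    p∣d = divides (product ps) (≡.trans d≡ (*-comm p (product ps)))

geomSum : ℕ → ℕ → ℕ
geomSum s zero    = 0
geomSum s (suc k) = s ^ k + geomSum s k

[1+t]^k≡1+t*U : ∀ t k → ∃ λ U → suc t ^ k ≡ 1 + t * U
[1+t]^k≡1+t*U t zero    = 0 , cong suc (≡.sym (*-zeroʳ t))
[1+t]^k≡1+t*U t (suc k) with U , eq ← [1+t]^k≡1+t*U t k =
  1 + U + t * U , ≡.trans (cong (suc t *_) eq) (identity t U)
  where
  identity : ∀ t U → suc t * (1 + t * U) ≡ 1 + t * (1 + U + t * U)
  identity = solve-∀

geomSum[1+t]≡t*T+k : ∀ t k → ∃ λ T → geomSum (suc t) k ≡ t * T + k
geomSum[1+t]≡t*T+k t zero    = 0 , ≡.sym (≡.trans (+-identityʳ (t * 0)) (*-zeroʳ t))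
geomSum[1+t]≡t*T+k t (suc k) with U , eq ← [1+t]^k≡1+t*U t k | T , eq′ ← geomSum[1+t]≡t*T+k t k =
  U + T , ≡.trans (≡.cong₂ _+_ eq eq′) (identity t U k T)
  where
  identity : ∀ t U k T → (1 + t * U) + (t * T + k) ≡ t * (U + T) + suc k
  identity = solve-∀

gcd-cofactor-coprime : ∀ {m n t} .{{_ : NonZero m}} → Coprime m n → m ∣ t * geomSum (suc t) n →
                       Coprime (gcd t m) (quotient (gcd[m,n]∣n t m))
gcd-cofactor-coprime {m} {n} {t} m⊥n m∣tS {e} (e∣d , e∣q) = m⊥n (∣-trans e∣q (quotient-∣ d∣m) , e∣n)
  where
  d = gcd t m
  d∣m = gcd[m,n]∣n t m
  d∣t = gcd[m,n]∣m t m
  q = quotient d∣m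
  s = quotient d∣t
  S = geomSum (suc t) n
  instance
    d≢0 : NonZero d
    d≢0 = ≢-nonZero (λ d≡0 → ≢-nonZero⁻¹ m (gcd[m,n]≡0⇒n≡0 t d≡0))
  q⊥s : Coprime q s
  q⊥s {f} (f∣q , f∣s) = ∣1⇒≡1 (*-cancelʳ-∣ d (≡.subst (f * d ∣_) (≡.sym (*-identityˡ d))
    (gcd-greatest (≡.subst (f * d ∣_) (≡.sym (m∣n⇒n≡quotient*m d∣t)) (*-monoˡ-∣ d f∣s))
                  (≡.subst (f * d ∣_) (≡.sym (m∣n⇒n≡quotient*m d∣m)) (*-monoˡ-∣ d f∣q)))))
  q∣S : q ∣ S
  q∣S = coprime-divisor q⊥s (*-cancelʳ-∣ d (≡.subst₂ _∣_ (m∣n⇒n≡quotient*m d∣m) t*S≡s*S*d m∣tS))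
    where
    t*S≡s*S*d : t * S ≡ s * S * d
    t*S≡s*S*d = ≡.trans (cong (_* S) (m∣n⇒n≡quotient*m d∣t)) (identity s d S)
      where
      identity : ∀ s d S → s * d * S ≡ s * S * d
      identity = solve-∀
  e∣n : e ∣ n
  e∣n with T , S≡ ← geomSum[1+t]≡t*T+k t n =
    ∣m+n∣m⇒∣n (≡.subst (e ∣_) S≡ (∣-trans e∣q q∣S)) (∣-trans (∣-trans e∣d d∣t) (m∣m*n T))

bézout-split : ∀ {d q X Y} .{{_ : NonZero d}} → 1 + Y * q ≡ X * d → ∀ u →
               ∃ λ A → ∃ λ B → d ∣ A × q ∣ B × A + B ≡ u + u * Y * (d * q)
bézout-split {d} {q} {X} {Y} eq u =
  u * X * d , u * Y * pred d * q , divides (u * X) refl , divides (u * Y * pred d) refl , (begin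
    u * X * d + u * Y * pred d * q         ≡⟨ cong (_+ u * Y * pred d * q) (≡.trans (*-assoc u X d) (cong (u *_) (≡.sym eq))) ⟩
    u * (1 + Y * q) + u * Y * pred d * q   ≡⟨ rearrange u Y q (pred d) ⟩
    u + u * Y * (suc (pred d) * q)         ≡⟨ cong (λ z → u + u * Y * (z * q)) (suc-pred d) ⟩
    u + u * Y * (d * q)                    ∎)
  where
  open ≡.≡-Reasoning
  rearrange : ∀ u Y q d′ → u * (1 + Y * q) + u * Y * d′ * q ≡ u + u * Y * (suc d′ * q)
  rearrange = solve-∀

coprime⇒split : ∀ {d q} .{{_ : NonZero d}} .{{_ : NonZero q}} → Coprime d q → ∀ u →
                ∃ λ A → ∃ λ B → d ∣ A × q ∣ B × ∃ λ k → A + B ≡ u + k * (d * q)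
coprime⇒split {d} {q} d⊥q u with coprime-Bézout d⊥q
... | Bézout.+- X Y eq with A , B , d∣A , q∣B , A+B≡ ← bézout-split {d} {q} {X} eq u = A , B , d∣A , q∣B , u * Y , A+B≡
... | Bézout.-+ X Y eq with A , B , q∣A , d∣B , A+B≡ ← bézout-split {q} {d} {Y} eq u =
  B , A , d∣B , q∣A , u * X , ≡.trans (+-comm B A) (≡.trans A+B≡ (cong (λ z → u + u * X * z) (*-comm q d)))

Fin-injective⇒surjective : ∀ {N} (f : Fin N → Fin N) → Injective _≡_ _≡_ f → ∀ y → ∃ λ x → f x ≡ y
Fin-injective⇒surjective {suc N} f f-injective y with Fin.any? (λ x → f x Fin.≟ y)
... | yes hit = hit
... | no miss = ⊥-elim (Fin.<⇒notInjective ≤-refl g-injective)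
  where
  g : Fin (suc N) → Fin N
  g x = punchOut (λ y≡fx → miss (x , ≡.sym y≡fx))
  g-injective : Injective _≡_ _≡_ g
  g-injective eq = f-injective (Fin.punchOut-injective {i = y} _ _ eq)

module Properties {c ℓ : Level} (G : Group c ℓ) where
  open Group G renaming (refl to ≈-refl)
  open GroupTheory G
  open import Algebra.Properties.Group G
  open import Algebra.Properties.Monoid.Mult monoid using (×-congʳ; ×-homo-+; ×-assocˡ) renaming (_×_ to _·_)
  open import Relation.Binary.Reasoning.Setoid setoid

  ^ᵍ≡· : ∀ g k → g ^ᵍ k ≡ k · g
  ^ᵍ≡· g zero    = refl
  ^ᵍ≡· g (suc k) = cong (g ∙_) (^ᵍ≡· g k)

  ^ᵍ-congˡ : ∀ k {g h} → g ≈ h → g ^ᵍ k ≈ h ^ᵍ k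
  ^ᵍ-congˡ k {g} {h} rewrite ^ᵍ≡· g k | ^ᵍ≡· h k = ×-congʳ k

  ^ᵍ-congʳ : ∀ g {x y} → x ≡ y → g ^ᵍ x ≈ g ^ᵍ y
  ^ᵍ-congʳ g refl = ≈-refl

  ^ᵍ-homo-+ : ∀ g x y → g ^ᵍ (x + y) ≈ g ^ᵍ x ∙ g ^ᵍ y
  ^ᵍ-homo-+ g x y rewrite ^ᵍ≡· g (x + y) | ^ᵍ≡· g x | ^ᵍ≡· g y = ×-homo-+ g x y

  ^ᵍ-assoc : ∀ g x y → (g ^ᵍ x) ^ᵍ y ≈ g ^ᵍ (x * y)
  ^ᵍ-assoc g x y rewrite ^ᵍ≡· (g ^ᵍ x) y | ^ᵍ≡· g x | ^ᵍ≡· g (x * y) | *-comm x y = ×-assocˡ g y x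

  ε^ᵍ : ∀ k → ε ^ᵍ k ≈ ε
  ε^ᵍ zero    = ≈-refl
  ε^ᵍ (suc k) = trans (identityˡ _) (ε^ᵍ k)

  ^ᵍ-comm : ∀ g x y → g ^ᵍ x ∙ g ^ᵍ y ≈ g ^ᵍ y ∙ g ^ᵍ x
  ^ᵍ-comm g x y = begin
    g ^ᵍ x ∙ g ^ᵍ y  ≈⟨ ^ᵍ-homo-+ g x y ⟨
    g ^ᵍ (x + y)     ≈⟨ ^ᵍ-congʳ g (+-comm x y) ⟩
    g ^ᵍ (y + x)     ≈⟨ ^ᵍ-homo-+ g y x ⟩
    g ^ᵍ y ∙ g ^ᵍ x  ∎

  ^ᵍ-∣ : ∀ {g N x} → g ^ᵍ N ≈ ε → N ∣ x → g ^ᵍ x ≈ ε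
  ^ᵍ-∣ {g} {N} g^N≈ε (divides q refl) = begin
    g ^ᵍ (q * N)    ≈⟨ ^ᵍ-congʳ g (*-comm q N) ⟩
    g ^ᵍ (N * q)    ≈⟨ ^ᵍ-assoc g N q ⟨
    (g ^ᵍ N) ^ᵍ q   ≈⟨ ^ᵍ-congˡ q g^N≈ε ⟩
    ε ^ᵍ q          ≈⟨ ε^ᵍ q ⟩
    ε               ∎

  ^ᵍ-% : ∀ {g N} x .{{_ : NonZero N}} → g ^ᵍ N ≈ ε → g ^ᵍ x ≈ g ^ᵍ (x % N)
  ^ᵍ-% {g} {N} x g^N≈ε = begin
    g ^ᵍ x                          ≈⟨ ^ᵍ-congʳ g (m≡m%n+[m/n]*n x N) ⟩
    g ^ᵍ (x % N + x / N * N)        ≈⟨ ^ᵍ-homo-+ g (x % N) (x / N * N) ⟩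
    g ^ᵍ (x % N) ∙ g ^ᵍ (x / N * N) ≈⟨ ∙-congˡ (^ᵍ-∣ g^N≈ε (n∣m*n (x / N))) ⟩
    g ^ᵍ (x % N) ∙ ε                ≈⟨ identityʳ _ ⟩
    g ^ᵍ (x % N)                    ∎

  ^ᵍ[x+y]≈ε⇒^ᵍx≈ε : ∀ {g} x y → g ^ᵍ (x + y) ≈ ε → g ^ᵍ y ≈ ε → g ^ᵍ x ≈ ε
  ^ᵍ[x+y]≈ε⇒^ᵍx≈ε {g} x y g^[x+y]≈ε g^y≈ε = begin
    g ^ᵍ x            ≈⟨ identityʳ _ ⟨
    g ^ᵍ x ∙ ε        ≈⟨ ∙-congˡ g^y≈ε ⟨
    g ^ᵍ x ∙ g ^ᵍ y   ≈⟨ ^ᵍ-homo-+ g x y ⟨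
    g ^ᵍ (x + y)      ≈⟨ g^[x+y]≈ε ⟩
    ε                 ∎

  ^ᵍ-gcd : ∀ {g} x y → g ^ᵍ x ≈ ε → g ^ᵍ y ≈ ε → g ^ᵍ gcd x y ≈ ε
  ^ᵍ-gcd {g} x y g^x≈ε g^y≈ε with Bézout.identity (gcd-GCD x y)
  ... | Bézout.+- X Y eq = ^ᵍ[x+y]≈ε⇒^ᵍx≈ε (gcd x y) (Y * y) (^ᵍ-∣ g^x≈ε (divides X eq)) (^ᵍ-∣ g^y≈ε (n∣m*n Y))
  ... | Bézout.-+ X Y eq = ^ᵍ[x+y]≈ε⇒^ᵍx≈ε (gcd x y) (X * x) (^ᵍ-∣ g^y≈ε (divides Y eq)) (^ᵍ-∣ g^x≈ε (n∣m*n X))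

  ^ᵍ-coprime⇒≈ε : ∀ {g x y} → g ^ᵍ x ≈ ε → g ^ᵍ y ≈ ε → Coprime x y → g ≈ ε
  ^ᵍ-coprime⇒≈ε {g} {x} {y} g^x≈ε g^y≈ε x⊥y =
    trans (sym (identityʳ g)) (≡.subst (λ k → g ^ᵍ k ≈ ε) (coprime⇒gcd≡1 x⊥y) (^ᵍ-gcd x y g^x≈ε g^y≈ε))

  hasOrder⇒∣ : ∀ {g N t} → HasOrder g N → g ^ᵍ t ≈ ε → N ∣ t
  hasOrder⇒∣ {g} {N} {t} (0<N , g^N≈ε , minimal) g^t≈ε = m%n≡0⇒n∣m t N t%N≡0
    where
    instance
      N≢0 : NonZero N
      N≢0 = >-nonZero 0<N
    t%N≡0 : t % N ≡ 0
    t%N≡0 = n≤0⇒n≡0 (≮⇒≥ λ 0<t%N → minimal (t % N) 0<t%N (m%n<n t N) (trans (sym (^ᵍ-% t g^N≈ε)) g^t≈ε))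

  ∣⇒hasOrder : ∀ {g N} → 0 < N → g ^ᵍ N ≈ ε → (∀ t → g ^ᵍ t ≈ ε → N ∣ t) → HasOrder g N
  ∣⇒hasOrder 0<N g^N≈ε N∣ = 0<N , g^N≈ε , λ j 0<j j<N g^j≈ε → <⇒≱ j<N (∣⇒≤ {{>-nonZero 0<j}} (N∣ j g^j≈ε))

  hasOrder-^ᵍ-coprime : ∀ {g N j} → HasOrder g N → Coprime j N → HasOrder (g ^ᵍ j) N
  hasOrder-^ᵍ-coprime {g} {N} {j} o@(0<N , g^N≈ε , _) j⊥N = ∣⇒hasOrder 0<N
    (trans (^ᵍ-assoc g j N) (^ᵍ-∣ g^N≈ε (n∣m*n j)))
    (λ t g^[j*t]≈ε → coprime-divisor (Coprimality.sym j⊥N) (hasOrder⇒∣ o (trans (sym (^ᵍ-assoc g j t)) g^[j*t]≈ε)))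

  hasOrder⇒^ᵍ-injective-≤ : ∀ {g N x y} → HasOrder g N → x ≤ y → y < N → g ^ᵍ x ≈ g ^ᵍ y → x ≡ y
  hasOrder⇒^ᵍ-injective-≤ {g} {N} {x} o x≤y y<N g^x≈g^y with m≤n⇒∃[o]m+o≡n x≤y
  ... | zero  , refl = ≡.sym (+-identityʳ x)
  ... | suc t , refl = ⊥-elim (>⇒∤ (≤-<-trans (m≤n+m (suc t) x) y<N) (hasOrder⇒∣ o g^[1+t]≈ε))
    where
    g^[1+t]≈ε : g ^ᵍ suc t ≈ ε
    g^[1+t]≈ε = identityʳ-unique (g ^ᵍ x) _ (sym (trans g^x≈g^y (^ᵍ-homo-+ g x (suc t))))

  hasOrder⇒^ᵍ-injective : ∀ {g N x y} → HasOrder g N → x < N → y < N → g ^ᵍ x ≈ g ^ᵍ y → x ≡ y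
  hasOrder⇒^ᵍ-injective {x = x} {y} o x<N y<N g^x≈g^y with ≤-total x y
  ... | inj₁ x≤y = hasOrder⇒^ᵍ-injective-≤ o x≤y y<N g^x≈g^y
  ... | inj₂ y≤x = ≡.sym (hasOrder⇒^ᵍ-injective-≤ o y≤x x<N (sym g^x≈g^y))

  hasOrder-^ᵍ-divisor : ∀ {g L β} .{{_ : NonZero β}} → HasOrder g (L * β) → HasOrder (g ^ᵍ β) L
  hasOrder-^ᵍ-divisor {g} {L} {β} o@(0<Lβ , g^Lβ≈ε , _) = ∣⇒hasOrder
    (>-nonZero⁻¹ L {{m*n≢0⇒m≢0 L {{>-nonZero 0<Lβ}}}})
    (trans (^ᵍ-assoc g β L) (trans (^ᵍ-congʳ g (*-comm β L)) g^Lβ≈ε))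
    (λ t [g^β]^t≈ε → *-cancelʳ-∣ β (hasOrder⇒∣ o
       (trans (^ᵍ-congʳ g (*-comm t β)) (trans (sym (^ᵍ-assoc g β t)) [g^β]^t≈ε))))

  hasOrder-cofactor : ∀ {g N p} q → HasOrder g N → N ≡ q * p → 1 < p → ¬ g ^ᵍ q ≈ ε × (g ^ᵍ q) ^ᵍ p ≈ ε
  hasOrder-cofactor {g} {N} {p} q (0<N , g^N≈ε , minimal) N≡q*p 1<p =
    minimal q (>-nonZero⁻¹ q) (≡.subst (q <_) (≡.sym N≡q*p) (m<m*n q p 1<p)) ,
    trans (^ᵍ-assoc g q p) (trans (^ᵍ-congʳ g (≡.sym N≡q*p)) g^N≈ε)
    where
    instance
      q≢0 : NonZero q
      q≢0 = m*n≢0⇒m≢0 q {{≡.subst NonZero N≡q*p (>-nonZero 0<N)}}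

  ⟨_⟩ : Carrier → Carrier → Set (c ⊔ ℓ)
  ⟨ g ⟩ x = Lift c (∃ λ k → x ≈ g ^ᵍ k)

  ^ᵍ∈⟨⟩ : ∀ g k → ⟨ g ⟩ (g ^ᵍ k)
  ^ᵍ∈⟨⟩ g k = lift (k , ≈-refl)

  ^ᵍ-inverse : ∀ {g N} x .{{_ : NonZero N}} → g ^ᵍ N ≈ ε → (g ^ᵍ x) ⁻¹ ≈ g ^ᵍ (x * pred N)
  ^ᵍ-inverse {g} {N} x g^N≈ε = sym (inverseʳ-unique _ _ (begin
    g ^ᵍ x ∙ g ^ᵍ (x * pred N)  ≈⟨ ^ᵍ-homo-+ g x (x * pred N) ⟨
    g ^ᵍ (x + x * pred N)       ≈⟨ ^ᵍ-congʳ g (≡.trans (≡.sym (*-suc x (pred N))) (cong (x *_) (suc-pred N))) ⟩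
    g ^ᵍ (x * N)                ≈⟨ ^ᵍ-∣ g^N≈ε (n∣m*n x) ⟩
    ε                           ∎))

  ⟨⟩-isSubgroup : ∀ {g N} .{{_ : NonZero N}} → g ^ᵍ N ≈ ε → IsSubgroup ⟨ g ⟩
  ⟨⟩-isSubgroup {g} {N} g^N≈ε = record
    { resp = λ { x≈y (lift (k , x≈g^k)) → lift (k , trans (sym x≈y) x≈g^k) }
    ; ε∈   = ^ᵍ∈⟨⟩ g 0
    ; ∙∈   = λ { (lift (k , x≈)) (lift (k′ , y≈)) → lift (k + k′ , trans (∙-cong x≈ y≈) (sym (^ᵍ-homo-+ g k k′))) }
    ; ⁻¹∈  = λ { (lift (k , x≈)) → lift (k * pred N , trans (⁻¹-cong x≈) (^ᵍ-inverse k g^N≈ε)) }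
    }

  ∈⟨^ᵍ-coprime⟩ : ∀ {g N s} .{{_ : NonZero N}} → g ^ᵍ N ≈ ε → Coprime s N → ⟨ g ^ᵍ s ⟩ g
  ∈⟨^ᵍ-coprime⟩ {g} {N} {s} g^N≈ε s⊥N with coprime-Bézout s⊥N
  ... | Bézout.+- X Y eq = lift (X , (begin
    g                  ≈⟨ identityʳ g ⟨
    g ∙ ε              ≈⟨ ∙-congˡ (^ᵍ-∣ g^N≈ε (n∣m*n Y)) ⟨
    g ^ᵍ (1 + Y * N)   ≈⟨ ^ᵍ-congʳ g (≡.trans eq (*-comm X s)) ⟩
    g ^ᵍ (s * X)       ≈⟨ ^ᵍ-assoc g s X ⟨
    (g ^ᵍ s) ^ᵍ X      ∎))
  ... | Bézout.-+ X Y eq = IsSubgroup.resp ⟨g^s⟩-isSubgroup (sym g≈[g^sX]⁻¹)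
                             (IsSubgroup.⁻¹∈ ⟨g^s⟩-isSubgroup (^ᵍ∈⟨⟩ (g ^ᵍ s) X))
    where
    ⟨g^s⟩-isSubgroup : IsSubgroup ⟨ g ^ᵍ s ⟩
    ⟨g^s⟩-isSubgroup = ⟨⟩-isSubgroup (trans (^ᵍ-assoc g s N) (^ᵍ-∣ g^N≈ε (n∣m*n s)))
    g≈[g^sX]⁻¹ : g ≈ ((g ^ᵍ s) ^ᵍ X) ⁻¹
    g≈[g^sX]⁻¹ = inverseˡ-unique g _ (begin
      g ∙ (g ^ᵍ s) ^ᵍ X   ≈⟨ ∙-congˡ (^ᵍ-assoc g s X) ⟩
      g ^ᵍ (1 + s * X)    ≈⟨ ^ᵍ-congʳ g (≡.trans (cong suc (*-comm s X)) eq) ⟩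
      g ^ᵍ (Y * N)        ≈⟨ ^ᵍ-∣ g^N≈ε (n∣m*n Y) ⟩
      ε                   ∎)

  Commute : Carrier → Carrier → Set ℓ
  Commute x y = x ∙ y ≈ y ∙ x

  commute-respʳ : ∀ {x y y′} → y ≈ y′ → Commute x y → Commute x y′
  commute-respʳ y≈y′ xy≈yx = trans (∙-congˡ (sym y≈y′)) (trans xy≈yx (∙-congʳ y≈y′))

  commute-respˡ : ∀ {x x′ y} → x ≈ x′ → Commute x y → Commute x′ y
  commute-respˡ x≈x′ xy≈yx = trans (∙-congʳ (sym x≈x′)) (trans xy≈yx (∙-congˡ x≈x′))

  commuteʳ-∙ : ∀ {x y z} → Commute x y → Commute x z → Commute x (y ∙ z)
  commuteʳ-∙ {x} {y} {z} xy≈yx xz≈zx = begin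
    x ∙ (y ∙ z)   ≈⟨ assoc x y z ⟨
    (x ∙ y) ∙ z   ≈⟨ ∙-congʳ xy≈yx ⟩
    (y ∙ x) ∙ z   ≈⟨ assoc y x z ⟩
    y ∙ (x ∙ z)   ≈⟨ ∙-congˡ xz≈zx ⟩
    y ∙ (z ∙ x)   ≈⟨ assoc y z x ⟨
    (y ∙ z) ∙ x   ∎

  ^ᵍ-commute : ∀ g k → Commute (g ^ᵍ k) g
  ^ᵍ-commute g k = commute-respʳ (identityʳ g) (^ᵍ-comm g k 1)

  commuteʳ-^ᵍ : ∀ {x y} k → Commute x y → Commute x (y ^ᵍ k)
  commuteʳ-^ᵍ {x} {y} zero    _     = trans (identityʳ x) (sym (identityˡ x))
  commuteʳ-^ᵍ {x} {y} (suc k) xy≈yx = begin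
    x ∙ (y ∙ y ^ᵍ k)   ≈⟨ assoc x y _ ⟨
    (x ∙ y) ∙ y ^ᵍ k   ≈⟨ ∙-congʳ xy≈yx ⟩
    (y ∙ x) ∙ y ^ᵍ k   ≈⟨ assoc y x _ ⟩
    y ∙ (x ∙ y ^ᵍ k)   ≈⟨ ∙-congˡ (commuteʳ-^ᵍ k xy≈yx) ⟩
    y ∙ (y ^ᵍ k ∙ x)   ≈⟨ assoc y _ x ⟨
    (y ∙ y ^ᵍ k) ∙ x   ∎

  commuteʳ-⟨⟩ : ∀ {x g y} → Commute x g → ⟨ g ⟩ y → Commute x y
  commuteʳ-⟨⟩ xg≈gx (lift (k , y≈g^k)) = commute-respʳ (sym y≈g^k) (commuteʳ-^ᵍ k xg≈gx)

  commuteʳ-cancelʳ : ∀ {x y z} → Commute x (y ∙ z) → Commute x z → Commute x y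
  commuteʳ-cancelʳ {x} {y} {z} x[yz]≈[yz]x xz≈zx = ∙-cancelʳ z (x ∙ y) (y ∙ x) (begin
    (x ∙ y) ∙ z   ≈⟨ assoc x y z ⟩
    x ∙ (y ∙ z)   ≈⟨ x[yz]≈[yz]x ⟩
    (y ∙ z) ∙ x   ≈⟨ assoc y z x ⟩
    y ∙ (z ∙ x)   ≈⟨ ∙-congˡ xz≈zx ⟨
    y ∙ (x ∙ z)   ≈⟨ assoc y x z ⟨
    (y ∙ x) ∙ z   ∎)

  cyclic⇒abelian : ∀ {g} → (∀ x → ⟨ g ⟩ x) → IsAbelian
  cyclic⇒abelian {g} G≡⟨g⟩ x y with lift (k , x≈g^k) ← G≡⟨g⟩ x | lift (k′ , y≈g^k′) ← G≡⟨g⟩ y =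
    trans (∙-cong x≈g^k y≈g^k′) (trans (^ᵍ-comm g k k′) (sym (∙-cong y≈g^k′ x≈g^k)))

  ⟨⟩-resp : ∀ {x x′ y y′} → x ≈ x′ → y ≈ y′ → ⟨ x ⟩ y → ⟨ x′ ⟩ y′
  ⟨⟩-resp x≈x′ y≈y′ (lift (k , y≈x^k)) = lift (k , trans (sym y≈y′) (trans y≈x^k (^ᵍ-congˡ k x≈x′)))

  ⟨⟩-^ᵍ : ∀ {x y} k → ⟨ x ⟩ y → ⟨ x ⟩ (y ^ᵍ k)
  ⟨⟩-^ᵍ {x} k (lift (j , y≈x^j)) = lift (j * k , trans (^ᵍ-congˡ k y≈x^j) (^ᵍ-assoc x j k))

  ⟨⟩-trans : ∀ {x y z} → ⟨ x ⟩ y → ⟨ y ⟩ z → ⟨ x ⟩ z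
  ⟨⟩-trans y∈⟨x⟩ (lift (k , z≈y^k)) = ⟨⟩-resp ≈-refl (sym z≈y^k) (⟨⟩-^ᵍ k y∈⟨x⟩)

  ^ᵍ[s*p]≈ε⇒p^e∣s : ∀ {g p e} s → Prime p → g ^ᵍ (p ^ suc e) ≈ ε → ¬ g ^ᵍ (p ^ e) ≈ ε →
                    g ^ᵍ (s * p) ≈ ε → p ^ e ∣ s
  ^ᵍ[s*p]≈ε⇒p^e∣s {g} {p} {e} s p-prime g^p^[1+e]≈ε g^p^e≉ε g^[s*p]≈ε
    with ∣p^[1+e]⇒≡⊎∣p^e e p-prime (gcd[m,n]∣n (s * p) (p ^ suc e))
  ... | inj₁ D≡p^[1+e] = *-cancelʳ-∣ p {{prime⇒nonZero p-prime}}
    (≡.subst (_∣ s * p) (≡.trans D≡p^[1+e] (*-comm p (p ^ e))) (gcd[m,n]∣m (s * p) (p ^ suc e)))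
  ... | inj₂ D∣p^e = ⊥-elim (g^p^e≉ε (^ᵍ-∣ (^ᵍ-gcd (s * p) (p ^ suc e) g^[s*p]≈ε g^p^[1+e]≈ε) D∣p^e))

  powers-of-order-p-in-cyclic-p-group : ∀ {g p} e s t → Prime p → g ^ᵍ (p ^ e) ≈ ε →
    ¬ g ^ᵍ s ≈ ε → g ^ᵍ (s * p) ≈ ε → g ^ᵍ (t * p) ≈ ε → ¬ ¬ ⟨ g ^ᵍ s ⟩ (g ^ᵍ t)
  powers-of-order-p-in-cyclic-p-group {g} zero s t _ g^1≈ε g^s≉ε _ _ _ =
    g^s≉ε (trans (^ᵍ-congˡ s (trans (sym (identityʳ g)) g^1≈ε)) (ε^ᵍ s))
  -- Unless already g ^ᵍ p ^ e ≈ ε, both s and t are multiples of p ^ e and h = g ^ᵍ p ^ e has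
  -- order p, so h, and with it g ^ᵍ t, is a power of g ^ᵍ s.
  powers-of-order-p-in-cyclic-p-group {g} {p} (suc e) s t p-prime g^p^[1+e]≈ε g^s≉ε g^[s*p]≈ε g^[t*p]≈ε g^t∉⟨g^s⟩
    with ^ᵍ[s*p]≈ε⇒p^e∣s {e = e} s p-prime g^p^[1+e]≈ε g^p^e≉ε g^[s*p]≈ε
       | ^ᵍ[s*p]≈ε⇒p^e∣s {e = e} t p-prime g^p^[1+e]≈ε g^p^e≉ε g^[t*p]≈ε
    where
    g^p^e≉ε : ¬ g ^ᵍ (p ^ e) ≈ ε
    g^p^e≉ε g^p^e≈ε = powers-of-order-p-in-cyclic-p-group e s t p-prime g^p^e≈ε g^s≉ε g^[s*p]≈ε g^[t*p]≈ε g^t∉⟨g^s⟩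
  ... | divides q refl | divides q′ refl =
    g^t∉⟨g^s⟩ (⟨⟩-resp (h^q≈g^[q*p^e] q) (h^q≈g^[q*p^e] q′) (⟨⟩-^ᵍ q′ h∈⟨h^q⟩))
    where
    h = g ^ᵍ (p ^ e)
    h^q≈g^[q*p^e] : ∀ q → h ^ᵍ q ≈ g ^ᵍ (q * p ^ e)
    h^q≈g^[q*p^e] q = trans (^ᵍ-assoc g (p ^ e) q) (^ᵍ-congʳ g (*-comm (p ^ e) q))
    h^p≈ε : h ^ᵍ p ≈ ε
    h^p≈ε = trans (h^q≈g^[q*p^e] p) g^p^[1+e]≈ε
    p∤q : ¬ p ∣ q
    p∤q p∣q = g^s≉ε (trans (sym (h^q≈g^[q*p^e] q)) (^ᵍ-∣ h^p≈ε p∣q))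
    h∈⟨h^q⟩ : ⟨ h ^ᵍ q ⟩ h
    h∈⟨h^q⟩ = ∈⟨^ᵍ-coprime⟩ {{prime⇒nonZero p-prime}} h^p≈ε (prime⇒¬∣⇒coprime p-prime p∤q)

  cyclic-p-group-has-unique-subgroup-of-order-p : ∀ {g p e x y} → Prime p → g ^ᵍ (p ^ e) ≈ ε →
    ⟨ g ⟩ x → ⟨ g ⟩ y → ¬ x ≈ ε → x ^ᵍ p ≈ ε → y ^ᵍ p ≈ ε → ¬ ¬ ⟨ x ⟩ y
  cyclic-p-group-has-unique-subgroup-of-order-p {g} {p} {e} p-prime g^p^e≈ε
    (lift (s , x≈g^s)) (lift (t , y≈g^t)) x≉ε x^p≈ε y^p≈ε y∉⟨x⟩ =
    powers-of-order-p-in-cyclic-p-group e s t p-prime g^p^e≈ε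
      (λ g^s≈ε → x≉ε (trans x≈g^s g^s≈ε)) (^ᵍ[k*p]≈ε s x≈g^s x^p≈ε) (^ᵍ[k*p]≈ε t y≈g^t y^p≈ε)
      (λ g^t∈⟨g^s⟩ → y∉⟨x⟩ (⟨⟩-resp (sym x≈g^s) (sym y≈g^t) g^t∈⟨g^s⟩))
    where
    ^ᵍ[k*p]≈ε : ∀ {z} k → z ≈ g ^ᵍ k → z ^ᵍ p ≈ ε → g ^ᵍ (k * p) ≈ ε
    ^ᵍ[k*p]≈ε k z≈g^k z^p≈ε = trans (sym (^ᵍ-assoc g k p)) (trans (^ᵍ-congˡ p (sym z≈g^k)) z^p≈ε)

  cardinality-surjection⇒injective : ∀ {S N} → HasCardinality S N → (f : Fin N → Carrier) →
    (∀ x → S x → ∃ λ i → f i ≈ x) → ∀ i j → f i ≈ f j → i ≡ j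
  cardinality-surjection⇒injective {S} {N} card f f-onto i j fi≈fj =
    injective-on-image fi≈fj (Fin-injective⇒surjective h h-injective i) (Fin-injective⇒surjective h h-injective j)
    where
    open HasCardinality card
    h : Fin N → Fin N
    h k = proj₁ (f-onto (enum k) (enum-in k))
    f∘h≈enum : ∀ k → f (h k) ≈ enum k
    f∘h≈enum k = proj₂ (f-onto (enum k) (enum-in k))
    h-injective : Injective _≡_ _≡_ h
    h-injective {k} {k′} hk≡hk′ =
      enum-inj k k′ (trans (sym (f∘h≈enum k)) (trans (reflexive (cong f hk≡hk′)) (f∘h≈enum k′)))
    injective-on-image : ∀ {i j} → f i ≈ f j → ∃ (λ k → h k ≡ i) → ∃ (λ k → h k ≡ j) → i ≡ j
    injective-on-image fi≈fj (k , refl) (k′ , refl) =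
      cong h (enum-inj k k′ (trans (sym (f∘h≈enum k)) (trans fi≈fj (f∘h≈enum k′))))

  trivial-intersection⇒factorisation-unique : ∀ {H K} → IsSubgroup H → IsSubgroup K → (∀ x → H x → K x → x ≈ ε) →
    ∀ {x x′ y y′} → H x → H x′ → K y → K y′ → x ∙ y ≈ x′ ∙ y′ → x ≈ x′ × y ≈ y′
  trivial-intersection⇒factorisation-unique {H} {K} H-sub K-sub H∩K≈ε {x} {x′} {y} {y′} x∈H x′∈H y∈K y′∈K xy≈x′y′ =
    x≈x′ , ∙-cancelˡ x y y′ (trans xy≈x′y′ (∙-congʳ (sym x≈x′)))
    where
    module H = IsSubgroup H-sub
    module K = IsSubgroup K-sub
    z≈y′//y : x′ \\ x ≈ y′ // y
    z≈y′//y = x≈z//y (x′ \\ x) y y′ (begin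
      (x′ \\ x) ∙ y    ≈⟨ assoc (x′ ⁻¹) x y ⟩
      x′ \\ (x ∙ y)    ≈⟨ ∙-congˡ xy≈x′y′ ⟩
      x′ \\ (x′ ∙ y′)  ≈⟨ \\-leftDividesʳ x′ y′ ⟩
      y′               ∎)
    z≈ε : x′ \\ x ≈ ε
    z≈ε = H∩K≈ε _ (H.∙∈ (H.⁻¹∈ x′∈H) x∈H) (K.resp (sym z≈y′//y) (K.∙∈ y′∈K (K.⁻¹∈ y∈K)))
    x≈x′ : x ≈ x′
    x≈x′ = begin
      x                 ≈⟨ \\-leftDividesˡ x′ x ⟨
      x′ ∙ (x′ \\ x)    ≈⟨ ∙-congˡ z≈ε ⟩
      x′ ∙ ε            ≈⟨ identityʳ x′ ⟩
      x′                ∎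

  conjugate-central : ∀ {k g} → Commute k g → (g ⁻¹ ∙ k) ∙ g ≈ k
  conjugate-central {k} {g} kg≈gk = begin
    (g ⁻¹ ∙ k) ∙ g  ≈⟨ assoc (g ⁻¹) k g ⟩
    g \\ (k ∙ g)    ≈⟨ ∙-congˡ kg≈gk ⟩
    g \\ (g ∙ k)    ≈⟨ \\-leftDividesʳ g k ⟩
    k               ∎

  central-complement⇒directProduct : ∀ {H K} → IsSubgroup H → IsSubgroup K → (∀ {k} g → K k → Commute k g) →
    (∀ x → H x → K x → x ≈ ε) → (∀ g → ∃ λ h → ∃ λ k → H h × K k × g ≈ h ∙ k) →
    NonTrivial H → NonTrivial K → IsDirectProductOfNontrivial
  central-complement⇒directProduct {H} {K} H-sub K-sub K-central H∩K≈ε G≈HK H≠1 K≠1 =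
    H , K , (H-sub , H-normal) , (K-sub , K-normal) , H≠1 , K≠1 , H∩K≈ε , G≈HK
    where
    K-normal : ∀ g x → K x → K ((g ⁻¹ ∙ x) ∙ g)
    K-normal g x x∈K = IsSubgroup.resp K-sub (sym (conjugate-central (K-central g x∈K))) x∈K
    H-normal : ∀ g x → H x → H ((g ⁻¹ ∙ x) ∙ g)
    H-normal g x x∈H with h , k , h∈H , k∈K , g≈hk ← G≈HK g =
      IsSubgroup.resp H-sub (sym conj≈) (∙∈ (∙∈ (⁻¹∈ h∈H) x∈H) h∈H)
      where
      open IsSubgroup H-sub
      y = (h ⁻¹ ∙ x) ∙ h
      conj≈ : (g ⁻¹ ∙ x) ∙ g ≈ y
      conj≈ = begin
        (g ⁻¹ ∙ x) ∙ g                ≈⟨ ∙-cong (∙-congʳ (⁻¹-cong g≈hk)) g≈hk ⟩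
        ((h ∙ k) ⁻¹ ∙ x) ∙ (h ∙ k)    ≈⟨ ∙-congʳ (∙-congʳ (⁻¹-anti-homo-∙ h k)) ⟩
        ((k ⁻¹ ∙ h ⁻¹) ∙ x) ∙ (h ∙ k) ≈⟨ ∙-congʳ (assoc (k ⁻¹) (h ⁻¹) x) ⟩
        (k ⁻¹ ∙ (h ⁻¹ ∙ x)) ∙ (h ∙ k) ≈⟨ assoc (k ⁻¹) _ _ ⟩
        k ⁻¹ ∙ ((h ⁻¹ ∙ x) ∙ (h ∙ k)) ≈⟨ ∙-congˡ (assoc (h ⁻¹ ∙ x) h k) ⟨
        k ⁻¹ ∙ (y ∙ k)                ≈⟨ assoc (k ⁻¹) y k ⟨
        (k ⁻¹ ∙ y) ∙ k                ≈⟨ conjugate-central (sym (K-central y k∈K)) ⟩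
        y                             ∎

module Metacyclic {c ℓ} (G : Group c ℓ) where
  open Group G renaming (refl to ≈-refl)
  open GroupTheory G
  open Properties G
  open import Algebra.Properties.Group G
  open import Relation.Binary.Reasoning.Setoid setoid

  module Conjugation {r : ℕ} {a b : Carrier} (b⁻¹ab≈a^r : (b ⁻¹ ∙ a) ∙ b ≈ a ^ᵍ r) where
    a∙b≈b∙a^r : a ∙ b ≈ b ∙ a ^ᵍ r
    a∙b≈b∙a^r = begin
      a ∙ b                ≈⟨ \\-leftDividesˡ b (a ∙ b) ⟨
      b ∙ (b ⁻¹ ∙ (a ∙ b)) ≈⟨ ∙-congˡ (assoc (b ⁻¹) a b) ⟨
      b ∙ ((b ⁻¹ ∙ a) ∙ b) ≈⟨ ∙-congˡ b⁻¹ab≈a^r ⟩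
      b ∙ a ^ᵍ r           ∎

    a^u∙b≈b∙a^[u*r] : ∀ u → a ^ᵍ u ∙ b ≈ b ∙ a ^ᵍ (u * r)
    a^u∙b≈b∙a^[u*r] zero    = trans (identityˡ b) (sym (identityʳ b))
    a^u∙b≈b∙a^[u*r] (suc u) = begin
      (a ∙ a ^ᵍ u) ∙ b               ≈⟨ assoc a _ b ⟩
      a ∙ (a ^ᵍ u ∙ b)               ≈⟨ ∙-congˡ (a^u∙b≈b∙a^[u*r] u) ⟩
      a ∙ (b ∙ a ^ᵍ (u * r))         ≈⟨ assoc a b _ ⟨
      (a ∙ b) ∙ a ^ᵍ (u * r)         ≈⟨ ∙-congʳ a∙b≈b∙a^r ⟩
      (b ∙ a ^ᵍ r) ∙ a ^ᵍ (u * r)    ≈⟨ assoc b _ _ ⟩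
      b ∙ (a ^ᵍ r ∙ a ^ᵍ (u * r))    ≈⟨ ∙-congˡ (^ᵍ-homo-+ a r (u * r)) ⟨
      b ∙ a ^ᵍ (r + u * r)           ∎

    a^u∙b^v≈b^v∙a^[u*r^v] : ∀ u v → a ^ᵍ u ∙ b ^ᵍ v ≈ b ^ᵍ v ∙ a ^ᵍ (u * r ^ v)
    a^u∙b^v≈b^v∙a^[u*r^v] u zero    = begin
      a ^ᵍ u ∙ ε        ≈⟨ identityʳ _ ⟩
      a ^ᵍ u            ≈⟨ ^ᵍ-congʳ a (*-identityʳ u) ⟨
      a ^ᵍ (u * 1)      ≈⟨ identityˡ _ ⟨
      ε ∙ a ^ᵍ (u * 1)  ∎
    a^u∙b^v≈b^v∙a^[u*r^v] u (suc v) = begin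
      a ^ᵍ u ∙ (b ∙ b ^ᵍ v)                   ≈⟨ assoc _ b _ ⟨
      (a ^ᵍ u ∙ b) ∙ b ^ᵍ v                   ≈⟨ ∙-congʳ (a^u∙b≈b∙a^[u*r] u) ⟩
      (b ∙ a ^ᵍ (u * r)) ∙ b ^ᵍ v             ≈⟨ assoc b _ _ ⟩
      b ∙ (a ^ᵍ (u * r) ∙ b ^ᵍ v)             ≈⟨ ∙-congˡ (a^u∙b^v≈b^v∙a^[u*r^v] (u * r) v) ⟩
      b ∙ (b ^ᵍ v ∙ a ^ᵍ (u * r * r ^ v))     ≈⟨ assoc b _ _ ⟨
      (b ∙ b ^ᵍ v) ∙ a ^ᵍ (u * r * r ^ v)     ≈⟨ ∙-congˡ (^ᵍ-congʳ a (*-assoc u r (r ^ v))) ⟩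
      (b ∙ b ^ᵍ v) ∙ a ^ᵍ (u * (r * r ^ v))   ∎

    b^v∙a^u-mul : ∀ v u v′ u′ →
                  (b ^ᵍ v ∙ a ^ᵍ u) ∙ (b ^ᵍ v′ ∙ a ^ᵍ u′) ≈ b ^ᵍ (v + v′) ∙ a ^ᵍ (u * r ^ v′ + u′)
    b^v∙a^u-mul v u v′ u′ = begin
      (b ^ᵍ v ∙ a ^ᵍ u) ∙ (b ^ᵍ v′ ∙ a ^ᵍ u′)              ≈⟨ assoc _ _ _ ⟩
      b ^ᵍ v ∙ (a ^ᵍ u ∙ (b ^ᵍ v′ ∙ a ^ᵍ u′))              ≈⟨ ∙-congˡ (assoc _ _ _) ⟨
      b ^ᵍ v ∙ ((a ^ᵍ u ∙ b ^ᵍ v′) ∙ a ^ᵍ u′)              ≈⟨ ∙-congˡ (∙-congʳ (a^u∙b^v≈b^v∙a^[u*r^v] u v′)) ⟩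
      b ^ᵍ v ∙ ((b ^ᵍ v′ ∙ a ^ᵍ (u * r ^ v′)) ∙ a ^ᵍ u′)   ≈⟨ ∙-congˡ (assoc _ _ _) ⟩
      b ^ᵍ v ∙ (b ^ᵍ v′ ∙ (a ^ᵍ (u * r ^ v′) ∙ a ^ᵍ u′))   ≈⟨ assoc _ _ _ ⟨
      (b ^ᵍ v ∙ b ^ᵍ v′) ∙ (a ^ᵍ (u * r ^ v′) ∙ a ^ᵍ u′)
        ≈⟨ ∙-cong (^ᵍ-homo-+ b v v′) (^ᵍ-homo-+ a (u * r ^ v′) u′) ⟨
      b ^ᵍ (v + v′) ∙ a ^ᵍ (u * r ^ v′ + u′)               ∎

    [b^v∙a^u]^k : ∀ v u k → (b ^ᵍ v ∙ a ^ᵍ u) ^ᵍ k ≈ b ^ᵍ (v * k) ∙ a ^ᵍ (u * geomSum (r ^ v) k)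
    [b^v∙a^u]^k v u zero = begin
      ε                             ≈⟨ identityˡ ε ⟨
      ε ∙ ε                         ≈⟨ ∙-cong (^ᵍ-congʳ b (*-zeroʳ v)) (^ᵍ-congʳ a (*-zeroʳ u)) ⟨
      b ^ᵍ (v * 0) ∙ a ^ᵍ (u * 0)   ∎
    [b^v∙a^u]^k v u (suc k) = begin
      (b ^ᵍ v ∙ a ^ᵍ u) ∙ (b ^ᵍ v ∙ a ^ᵍ u) ^ᵍ k                   ≈⟨ ∙-congˡ ([b^v∙a^u]^k v u k) ⟩
      (b ^ᵍ v ∙ a ^ᵍ u) ∙ (b ^ᵍ (v * k) ∙ a ^ᵍ (u * S))            ≈⟨ b^v∙a^u-mul v u (v * k) (u * S) ⟩
      b ^ᵍ (v + v * k) ∙ a ^ᵍ (u * r ^ (v * k) + u * S)   ≈⟨ ∙-cong (^ᵍ-congʳ b (≡.sym (*-suc v k))) (^ᵍ-congʳ a exponent) ⟩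
      b ^ᵍ (v * suc k) ∙ a ^ᵍ (u * geomSum (r ^ v) (suc k))       ∎
      where
      S = geomSum (r ^ v) k
      exponent : u * r ^ (v * k) + u * S ≡ u * geomSum (r ^ v) (suc k)
      exponent = ≡.trans (cong (λ x → u * x + u * S) (≡.sym (^-*-assoc r v k))) (≡.sym (*-distribˡ-+ u _ S))

    module Finite {m n : ℕ} (a-order : HasOrder a m) (b-order : HasOrder b n) (|G|≡mn : HasOrderG (m * n))
                  (G≈⟨a⟩⟨b⟩ : ∀ g → ∃ λ i → ∃ λ j → g ≈ a ^ᵍ i ∙ b ^ᵍ j) where
      a^m≈ε : a ^ᵍ m ≈ ε
      a^m≈ε = proj₁ (proj₂ a-order)
      b^n≈ε : b ^ᵍ n ≈ ε
      b^n≈ε = proj₁ (proj₂ b-order)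
      instance
        m≢0 : NonZero m
        m≢0 = >-nonZero (proj₁ a-order)
        n≢0 : NonZero n
        n≢0 = >-nonZero (proj₁ b-order)

      ⟨a⟩-isSubgroup : IsSubgroup ⟨ a ⟩
      ⟨a⟩-isSubgroup = ⟨⟩-isSubgroup a^m≈ε
      ⟨b⟩-isSubgroup : IsSubgroup ⟨ b ⟩
      ⟨b⟩-isSubgroup = ⟨⟩-isSubgroup b^n≈ε

      normalForm : ∀ g → ∃ λ v → ∃ λ u → g ≈ b ^ᵍ v ∙ a ^ᵍ u
      normalForm g with i , j , g≈a^ib^j ← G≈⟨a⟩⟨b⟩ g = j , i * r ^ j , trans g≈a^ib^j (a^u∙b^v≈b^v∙a^[u*r^v] i j)

      a^∙b^ : Fin m × Fin n → Carrier
      a^∙b^ (i , j) = a ^ᵍ toℕ i ∙ b ^ᵍ toℕ j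

      aᵢbⱼ : Fin (m * n) → Carrier
      aᵢbⱼ k = a^∙b^ (remQuot n k)

      index : ℕ → ℕ → Fin (m * n)
      index i j = combine (fromℕ< (m%n<n i m)) (fromℕ< (m%n<n j n))

      aᵢbⱼ-index : ∀ i j → aᵢbⱼ (index i j) ≈ a ^ᵍ i ∙ b ^ᵍ j
      aᵢbⱼ-index i j = begin
        a^∙b^ (remQuot n (index i j))   ≡⟨ cong a^∙b^ (Fin.remQuot-combine (fromℕ< (m%n<n i m)) (fromℕ< (m%n<n j n))) ⟩
        a^∙b^ (fromℕ< (m%n<n i m) , fromℕ< (m%n<n j n))
                                        ≡⟨ ≡.cong₂ (λ x y → a ^ᵍ x ∙ b ^ᵍ y)
                                                   (Fin.toℕ-fromℕ< (m%n<n i m)) (Fin.toℕ-fromℕ< (m%n<n j n)) ⟩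
        a ^ᵍ (i % m) ∙ b ^ᵍ (j % n)     ≈⟨ ∙-cong (^ᵍ-% i a^m≈ε) (^ᵍ-% j b^n≈ε) ⟨
        a ^ᵍ i ∙ b ^ᵍ j                 ∎

      ⟨b⟩∩⟨a⟩≈ε : ∀ x → ⟨ b ⟩ x → ⟨ a ⟩ x → x ≈ ε
      ⟨b⟩∩⟨a⟩≈ε x (lift (v , x≈b^v)) (lift (u , x≈a^u)) = begin
        x              ≈⟨ x≈b^v ⟩
        b ^ᵍ v         ≈⟨ ^ᵍ-% v b^n≈ε ⟩
        b ^ᵍ (v % n)   ≈⟨ ^ᵍ-congʳ b v%n≡0%n ⟩
        b ^ᵍ (0 % n)   ≈⟨ ^ᵍ-% 0 b^n≈ε ⟨
        ε              ∎
        where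
        aᵢbⱼ-onto : ∀ g → Whole g → ∃ λ k → aᵢbⱼ k ≈ g
        aᵢbⱼ-onto g _ with i , j , g≈a^ib^j ← G≈⟨a⟩⟨b⟩ g = index i j , trans (aᵢbⱼ-index i j) (sym g≈a^ib^j)
        same-index : index u 0 ≡ index 0 v
        same-index = cardinality-surjection⇒injective |G|≡mn aᵢbⱼ aᵢbⱼ-onto _ _ (begin
          aᵢbⱼ (index u 0)  ≈⟨ aᵢbⱼ-index u 0 ⟩
          a ^ᵍ u ∙ ε        ≈⟨ identityʳ _ ⟩
          a ^ᵍ u            ≈⟨ x≈a^u ⟨
          x                 ≈⟨ x≈b^v ⟩
          b ^ᵍ v            ≈⟨ identityˡ _ ⟨
          ε ∙ b ^ᵍ v        ≈⟨ aᵢbⱼ-index 0 v ⟨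
          aᵢbⱼ (index 0 v)  ∎)
        v%n≡0%n : v % n ≡ 0 % n
        v%n≡0%n = ≡.trans (≡.sym (Fin.toℕ-fromℕ< (m%n<n v n)))
          (≡.trans (cong toℕ (≡.sym (Fin.combine-injectiveʳ (fromℕ< (m%n<n u m)) _ (fromℕ< (m%n<n 0 m)) _ same-index)))
                   (Fin.toℕ-fromℕ< (m%n<n 0 n)))

      ⟨b⟩⟨a⟩-factorisation-unique : ∀ {x x′ y y′} → ⟨ b ⟩ x → ⟨ b ⟩ x′ → ⟨ a ⟩ y → ⟨ a ⟩ y′ →
                                    x ∙ y ≈ x′ ∙ y′ → x ≈ x′ × y ≈ y′
      ⟨b⟩⟨a⟩-factorisation-unique = trivial-intersection⇒factorisation-unique ⟨b⟩-isSubgroup ⟨a⟩-isSubgroup ⟨b⟩∩⟨a⟩≈ε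

      ⟨b^_⟩⟨a^_⟩ : ℕ → ℕ → Carrier → Set (c ⊔ ℓ)
      ⟨b^ β ⟩⟨a^ α ⟩ x = Lift c (∃ λ v → ∃ λ u → β ∣ v × α ∣ u × x ≈ b ^ᵍ v ∙ a ^ᵍ u)

      ⟨b^⟩⟨a^⟩-isSubgroup : ∀ β α → IsSubgroup ⟨b^ β ⟩⟨a^ α ⟩
      ⟨b^⟩⟨a^⟩-isSubgroup β α = record
        { resp = λ { y≈x (lift (v , u , β∣v , α∣u , y≈)) → lift (v , u , β∣v , α∣u , trans (sym y≈x) y≈) }
        ; ε∈   = lift (0 , 0 , β ∣0 , α ∣0 , sym (identityˡ ε))
        ; ∙∈   = λ { (lift (v , u , β∣v , α∣u , x≈)) (lift (v′ , u′ , β∣v′ , α∣u′ , y≈)) →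
            lift (v + v′ , u * r ^ v′ + u′ , ∣m∣n⇒∣m+n β∣v β∣v′ , ∣m∣n⇒∣m+n (∣-trans α∣u (m∣m*n _)) α∣u′ ,
                  trans (∙-cong x≈ y≈) (b^v∙a^u-mul v u v′ u′)) }
        ; ⁻¹∈  = λ { {x} (lift (v , u , β∣v , α∣u , x≈)) →
            lift (v * pred n , u * pred m * r ^ (v * pred n) , ∣-trans β∣v (m∣m*n _) ,
                  ∣-trans α∣u (∣-trans (m∣m*n (pred m)) (m∣m*n _)) , (begin
              x ⁻¹                                ≈⟨ ⁻¹-cong x≈ ⟩
              (b ^ᵍ v ∙ a ^ᵍ u) ⁻¹                ≈⟨ ⁻¹-anti-homo-∙ _ _ ⟩
              (a ^ᵍ u) ⁻¹ ∙ (b ^ᵍ v) ⁻¹           ≈⟨ ∙-cong (^ᵍ-inverse u a^m≈ε) (^ᵍ-inverse v b^n≈ε) ⟩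
              a ^ᵍ (u * pred m) ∙ b ^ᵍ (v * pred n) ≈⟨ a^u∙b^v≈b^v∙a^[u*r^v] (u * pred m) (v * pred n) ⟩
              b ^ᵍ (v * pred n) ∙ a ^ᵍ (u * pred m * r ^ (v * pred n)) ∎)) }
        }

      ⟨b^⟩⟨a^⟩-exponent : ∀ {β α L K x} → n ∣ β * L → m ∣ α * K → ⟨b^ β ⟩⟨a^ α ⟩ x → x ^ᵍ (L * K) ≈ ε
      ⟨b^⟩⟨a^⟩-exponent {β} {α} {L} {K} {x} n∣βL m∣αK (lift (_ , _ , divides qv refl , divides qu refl , x≈)) = begin
        x ^ᵍ (L * K)                                   ≈⟨ ^ᵍ-assoc x L K ⟨
        (x ^ᵍ L) ^ᵍ K                                  ≈⟨ ^ᵍ-congˡ K (trans (^ᵍ-congˡ L x≈) ([b^v∙a^u]^k (qv * β) (qu * α) L)) ⟩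
        (b ^ᵍ (qv * β * L) ∙ a ^ᵍ (qu * α * S)) ^ᵍ K    ≈⟨ ^ᵍ-congˡ K (∙-congʳ (^ᵍ-∣ b^n≈ε n∣qvβL)) ⟩
        (ε ∙ a ^ᵍ (qu * α * S)) ^ᵍ K                   ≈⟨ ^ᵍ-congˡ K (identityˡ _) ⟩
        (a ^ᵍ (qu * α * S)) ^ᵍ K                       ≈⟨ ^ᵍ-assoc a (qu * α * S) K ⟩
        a ^ᵍ (qu * α * S * K)                          ≈⟨ ^ᵍ-∣ a^m≈ε m∣quαSK ⟩
        ε                                              ∎
        where
        S = geomSum (r ^ (qv * β)) L
        n∣qvβL : n ∣ qv * β * L
        n∣qvβL = ≡.subst (n ∣_) (≡.sym (*-assoc qv β L)) (∣-trans n∣βL (n∣m*n qv))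
        m∣quαSK : m ∣ qu * α * S * K
        m∣quαSK = ≡.subst (m ∣_) (rearrange qu S α K) (∣-trans m∣αK (n∣m*n (qu * S)))
          where
          rearrange : ∀ qu S α K → qu * S * (α * K) ≡ qu * α * S * K
          rearrange = solve-∀

      ⟨b^⟩⟨a^⟩-cardinality : ∀ {β α L K} → HasOrder (b ^ᵍ β) L → HasOrder (a ^ᵍ α) K →
                             HasCardinality ⟨b^ β ⟩⟨a^ α ⟩ (L * K)
      ⟨b^⟩⟨a^⟩-cardinality {β} {α} {L} {K} b^β-order a^α-order = record
        { enum      = enum
        ; enum-in   = λ k → B^∙A^∈ (remQuot K k)
        ; enum-inj  = λ k k′ enum-k≈enum-k′ → ≡.trans (≡.sym (Fin.combine-remQuot {L} K k))
            (≡.trans (cong (λ (Y , X) → combine Y X) (B^∙A^-injective {remQuot K k} {remQuot K k′} enum-k≈enum-k′))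
                     (Fin.combine-remQuot {L} K k′))
        ; enum-surj = enum-surj
        }
        where
        instance
          L≢0 : NonZero L
          L≢0 = >-nonZero (proj₁ b^β-order)
          K≢0 : NonZero K
          K≢0 = >-nonZero (proj₁ a^α-order)
        B = b ^ᵍ β
        A = a ^ᵍ α
        B^∙A^ : Fin L × Fin K → Carrier
        B^∙A^ (Y , X) = B ^ᵍ toℕ Y ∙ A ^ᵍ toℕ X
        enum : Fin (L * K) → Carrier
        enum k = B^∙A^ (remQuot K k)
        B^∙A^∈ : ∀ YX → ⟨b^ β ⟩⟨a^ α ⟩ (B^∙A^ YX)
        B^∙A^∈ (Y , X) =
          lift (β * toℕ Y , α * toℕ X , m∣m*n (toℕ Y) , m∣m*n (toℕ X) , ∙-cong (^ᵍ-assoc b β _) (^ᵍ-assoc a α _))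
        B^∙A^-injective : ∀ {YX Y′X′} → B^∙A^ YX ≈ B^∙A^ Y′X′ → YX ≡ Y′X′
        B^∙A^-injective {Y , X} {Y′ , X′} eq with B^Y≈B^Y′ , A^X≈A^X′ ←
          ⟨b⟩⟨a⟩-factorisation-unique (⟨⟩-^ᵍ (toℕ Y) (^ᵍ∈⟨⟩ b β)) (⟨⟩-^ᵍ (toℕ Y′) (^ᵍ∈⟨⟩ b β))
                                      (⟨⟩-^ᵍ (toℕ X) (^ᵍ∈⟨⟩ a α)) (⟨⟩-^ᵍ (toℕ X′) (^ᵍ∈⟨⟩ a α)) eq =
          ≡.cong₂ _,_ (Fin.toℕ-injective (hasOrder⇒^ᵍ-injective b^β-order (Fin.toℕ<n Y) (Fin.toℕ<n Y′) B^Y≈B^Y′))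
                      (Fin.toℕ-injective (hasOrder⇒^ᵍ-injective a^α-order (Fin.toℕ<n X) (Fin.toℕ<n X′) A^X≈A^X′))
        enum-surj : ∀ x → ⟨b^ β ⟩⟨a^ α ⟩ x → ∃ λ k → enum k ≈ x
        enum-surj x (lift (_ , _ , divides qv refl , divides qu refl , x≈)) = combine Y X , (begin
          B^∙A^ (remQuot K (combine Y X))   ≡⟨ cong B^∙A^ (Fin.remQuot-combine Y X) ⟩
          B ^ᵍ toℕ Y ∙ A ^ᵍ toℕ X           ≡⟨ ≡.cong₂ (λ y x → B ^ᵍ y ∙ A ^ᵍ x)
                                                 (Fin.toℕ-fromℕ< (m%n<n qv L)) (Fin.toℕ-fromℕ< (m%n<n qu K)) ⟩
          B ^ᵍ (qv % L) ∙ A ^ᵍ (qu % K)     ≈⟨ ∙-cong (^ᵍ-% qv (proj₁ (proj₂ b^β-order)))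
                                                       (^ᵍ-% qu (proj₁ (proj₂ a^α-order))) ⟨
          B ^ᵍ qv ∙ A ^ᵍ qu                 ≈⟨ ∙-cong (^ᵍ-assoc b β qv) (^ᵍ-assoc a α qu) ⟩
          b ^ᵍ (β * qv) ∙ a ^ᵍ (α * qu)     ≈⟨ ∙-cong (^ᵍ-congʳ b (*-comm β qv)) (^ᵍ-congʳ a (*-comm α qu)) ⟩
          b ^ᵍ (qv * β) ∙ a ^ᵍ (qu * α)     ≈⟨ x≈ ⟨
          x                                 ∎)
          where
          Y = fromℕ< (m%n<n qv L)
          X = fromℕ< (m%n<n qu K)

      ⟨b^⟩⟨a^⟩-isSylow : ∀ {p k l m′ n′} → Prime p → m ≡ p ^ k * m′ → n ≡ p ^ l * n′ → ¬ p ∣ m′ → ¬ p ∣ n′ →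
                         IsSylow (m * n) p ⟨b^ n′ ⟩⟨a^ m′ ⟩
      ⟨b^⟩⟨a^⟩-isSylow {p} {k} {l} {m′} {n′} p-prime m≡p^k*m′ n≡p^l*n′ p∤m′ p∤n′ =
        ⟨b^⟩⟨a^⟩-isSubgroup n′ m′ , l + k ,
        ≡.subst (HasCardinality ⟨b^ n′ ⟩⟨a^ m′ ⟩) (≡.sym (^-distribˡ-+-* p l k))
          (⟨b^⟩⟨a^⟩-cardinality (hasOrder-^ᵍ-divisor {L = p ^ l} b-order′) (hasOrder-^ᵍ-divisor {L = p ^ k} a-order′)) ,
        lift (divides (m′ * n′) (≡.trans mn≡p^e*m′n′ (*-comm (p ^ (l + k)) (m′ * n′))) , p^[1+e]∤mn)
        where
        instance
          m′≢0 : NonZero m′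
          m′≢0 = m*n≢0⇒n≢0 (p ^ k) {{≡.subst NonZero m≡p^k*m′ m≢0}}
          n′≢0 : NonZero n′
          n′≢0 = m*n≢0⇒n≢0 (p ^ l) {{≡.subst NonZero n≡p^l*n′ n≢0}}
        a-order′ : HasOrder a (p ^ k * m′)
        a-order′ = ≡.subst (HasOrder a) m≡p^k*m′ a-order
        b-order′ : HasOrder b (p ^ l * n′)
        b-order′ = ≡.subst (HasOrder b) n≡p^l*n′ b-order
        mn≡p^e*m′n′ : m * n ≡ p ^ (l + k) * (m′ * n′)
        mn≡p^e*m′n′ = ≡.trans (≡.cong₂ _*_ m≡p^k*m′ n≡p^l*n′)
          (≡.trans (rearrange (p ^ k) m′ (p ^ l) n′) (cong (_* (m′ * n′)) (≡.sym (^-distribˡ-+-* p l k))))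
          where
          rearrange : ∀ K m′ L n′ → K * m′ * (L * n′) ≡ L * K * (m′ * n′)
          rearrange = solve-∀
        p^[1+e]∤mn : ¬ p ^ suc (l + k) ∣ m * n
        p^[1+e]∤mn p^[1+e]∣mn with euclidsLemma m′ n′ p-prime
          (*-cancelˡ-∣ (p ^ (l + k)) {{m^n≢0 p (l + k) {{prime⇒nonZero p-prime}}}}
            (≡.subst₂ _∣_ (*-comm p (p ^ (l + k))) mn≡p^e*m′n′ p^[1+e]∣mn))
        ... | inj₁ p∣m′ = p∤m′ p∣m′
        ... | inj₂ p∣n′ = p∤n′ p∣n′

      sylow-cyclic⇒no-common-prime-factor : AllSylowCyclic (m * n) → ∀ {p} → Prime p → p ∣ m → p ∣ n → ⊥
      sylow-cyclic⇒no-common-prime-factor sylow-cyclic {p} p-prime (divides qm m≡qm*p) (divides qn n≡qn*p)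
        with k , m′ , m≡p^k*m′ , p∤m′ ← p-part {{prime⇒nonTrivial p-prime}} m
           | l , n′ , n≡p^l*n′ , p∤n′ ← p-part {{prime⇒nonTrivial p-prime}} n
        with g , g∈P , P⊆⟨g⟩ ← sylow-cyclic p p-prime _
                                   (⟨b^⟩⟨a^⟩-isSylow {k = k} {l} p-prime m≡p^k*m′ n≡p^l*n′ p∤m′ p∤n′) =
        cyclic-p-group-has-unique-subgroup-of-order-p {e = l + k} p-prime g^p^e≈ε
          (lift (P⊆⟨g⟩ α α∈P)) (lift (P⊆⟨g⟩ β β∈P)) α≉ε α^p≈ε β^p≈ε β∉⟨α⟩
        where
        1<p : 1 < p
        1<p = nonTrivial⇒n>1 p {{prime⇒nonTrivial p-prime}}
        g^p^e≈ε : g ^ᵍ (p ^ (l + k)) ≈ ε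
        g^p^e≈ε = trans (^ᵍ-congʳ g (^-distribˡ-+-* p l k)) (⟨b^⟩⟨a^⟩-exponent {L = p ^ l} {K = p ^ k}
          (∣-reflexive (≡.trans n≡p^l*n′ (*-comm (p ^ l) n′))) (∣-reflexive (≡.trans m≡p^k*m′ (*-comm (p ^ k) m′))) g∈P)
        coprime-part-∣ : ∀ {d q} → ¬ p ∣ d → d ∣ q * p → d ∣ q
        coprime-part-∣ {d} {q} p∤d d∣q*p =
          coprime-divisor (prime⇒¬∣⇒coprime p-prime p∤d) (≡.subst (d ∣_) (*-comm q p) d∣q*p)
        α = a ^ᵍ qm
        β = b ^ᵍ qn
        α≉ε : ¬ α ≈ ε
        α≉ε = proj₁ (hasOrder-cofactor qm a-order m≡qm*p 1<p)
        α^p≈ε : α ^ᵍ p ≈ ε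
        α^p≈ε = proj₂ (hasOrder-cofactor qm a-order m≡qm*p 1<p)
        β≉ε : ¬ β ≈ ε
        β≉ε = proj₁ (hasOrder-cofactor qn b-order n≡qn*p 1<p)
        β^p≈ε : β ^ᵍ p ≈ ε
        β^p≈ε = proj₂ (hasOrder-cofactor qn b-order n≡qn*p 1<p)
        α∈P : ⟨b^ n′ ⟩⟨a^ m′ ⟩ α
        α∈P = lift (0 , qm , n′ ∣0 , coprime-part-∣ p∤m′ (≡.subst (m′ ∣_) m≡qm*p (divides (p ^ k) m≡p^k*m′)) ,
                    sym (identityˡ α))
        β∈P : ⟨b^ n′ ⟩⟨a^ m′ ⟩ β
        β∈P = lift (qn , 0 , coprime-part-∣ p∤n′ (≡.subst (n′ ∣_) n≡qn*p (divides (p ^ l) n≡p^l*n′)) , m′ ∣0 ,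
                    sym (identityʳ β))
        β∉⟨α⟩ : ¬ ⟨ α ⟩ β
        β∉⟨α⟩ β∈⟨α⟩ = β≉ε (⟨b⟩∩⟨a⟩≈ε β (^ᵍ∈⟨⟩ b qn) (⟨⟩-trans (^ᵍ∈⟨⟩ a qm) β∈⟨α⟩))

      sylow-cyclic⇒coprime : AllSylowCyclic (m * n) → Coprime m n
      sylow-cyclic⇒coprime sylow-cyclic = no-common-prime⇒coprime (sylow-cyclic⇒no-common-prime-factor sylow-cyclic)

      n≡1⇒abelian : n ≡ 1 → IsAbelian
      n≡1⇒abelian refl = cyclic⇒abelian λ x → let (v , u , x≈b^va^u) = normalForm x in lift (u , (begin
        x                ≈⟨ x≈b^va^u ⟩
        b ^ᵍ v ∙ a ^ᵍ u  ≈⟨ ∙-congʳ (^ᵍ-∣ b^n≈ε (1∣ v)) ⟩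
        ε ∙ a ^ᵍ u       ≈⟨ identityˡ _ ⟩
        a ^ᵍ u           ∎))

      m≡1⇒abelian : m ≡ 1 → IsAbelian
      m≡1⇒abelian refl = cyclic⇒abelian λ x → let (v , u , x≈b^va^u) = normalForm x in lift (v , (begin
        x                ≈⟨ x≈b^va^u ⟩
        b ^ᵍ v ∙ a ^ᵍ u  ≈⟨ ∙-congˡ (^ᵍ-∣ a^m≈ε (1∣ u)) ⟩
        b ^ᵍ v ∙ ε       ≈⟨ identityʳ _ ⟩
        b ^ᵍ v           ∎))

      r≡0⇒m≡1 : r ≡ 0 → m ≡ 1
      r≡0⇒m≡1 refl = ∣1⇒≡1 (hasOrder⇒∣ a-order (∙-cancelʳ b (a ^ᵍ 1) ε (begin
        a ^ᵍ 1 ∙ b   ≈⟨ a^u∙b≈b∙a^[u*r] 1 ⟩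
        b ∙ ε        ≈⟨ identityʳ b ⟩
        b            ≈⟨ identityˡ b ⟨
        ε ∙ b        ∎)))

      module Centraliser {t : ℕ} (r≡1+t : r ≡ suc t) where
        a^[x*r]≈a^x∙a^[t*x] : ∀ x → a ^ᵍ (x * r) ≈ a ^ᵍ x ∙ a ^ᵍ (t * x)
        a^[x*r]≈a^x∙a^[t*x] x = trans (^ᵍ-congʳ a (≡.trans (cong (x *_) r≡1+t) (*-comm x (suc t)))) (^ᵍ-homo-+ a x (t * x))

        commute-b⇒m∣t* : ∀ x → Commute (a ^ᵍ x) b → m ∣ t * x
        commute-b⇒m∣t* x a^x∙b≈b∙a^x = hasOrder⇒∣ a-order (identityʳ-unique (a ^ᵍ x) _ (∙-cancelˡ b _ _ (begin
          b ∙ (a ^ᵍ x ∙ a ^ᵍ (t * x))   ≈⟨ ∙-congˡ (a^[x*r]≈a^x∙a^[t*x] x) ⟨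
          b ∙ a ^ᵍ (x * r)              ≈⟨ a^u∙b≈b∙a^[u*r] x ⟨
          a ^ᵍ x ∙ b                    ≈⟨ a^x∙b≈b∙a^x ⟩
          b ∙ a ^ᵍ x                    ∎)))

        m∣t*⇒commute-b : ∀ x → m ∣ t * x → Commute (a ^ᵍ x) b
        m∣t*⇒commute-b x m∣t*x = begin
          a ^ᵍ x ∙ b                    ≈⟨ a^u∙b≈b∙a^[u*r] x ⟩
          b ∙ a ^ᵍ (x * r)              ≈⟨ ∙-congˡ (a^[x*r]≈a^x∙a^[t*x] x) ⟩
          b ∙ (a ^ᵍ x ∙ a ^ᵍ (t * x))   ≈⟨ ∙-congˡ (∙-congˡ (^ᵍ-∣ a^m≈ε m∣t*x)) ⟩
          b ∙ (a ^ᵍ x ∙ ε)              ≈⟨ ∙-congˡ (identityʳ _) ⟩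
          b ∙ a ^ᵍ x                    ∎

        [b^v∙a^u]^n≈a^[u*S] : ∀ v u → (b ^ᵍ v ∙ a ^ᵍ u) ^ᵍ n ≈ a ^ᵍ (u * geomSum (r ^ v) n)
        [b^v∙a^u]^n≈a^[u*S] v u = trans ([b^v∙a^u]^k v u n) (trans (∙-congʳ (^ᵍ-∣ b^n≈ε (n∣m*n v))) (identityˡ _))

        m∣t*[u*S] : ∀ {v} u → Coprime v n → m ∣ t * (u * geomSum (r ^ v) n)
        m∣t*[u*S] {v} u v⊥n = commute-b⇒m∣t* (u * S) z-commutes-b
          where
          S = geomSum (r ^ v) n
          z = a ^ᵍ (u * S)
          z-commutes-b^v∙a^u : Commute z (b ^ᵍ v ∙ a ^ᵍ u)
          z-commutes-b^v∙a^u = commute-respˡ ([b^v∙a^u]^n≈a^[u*S] v u) (^ᵍ-commute _ n)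
          z-commutes-b : Commute z b
          z-commutes-b = commuteʳ-⟨⟩ (commuteʳ-cancelʳ z-commutes-b^v∙a^u (^ᵍ-comm a (u * S) u)) (∈⟨^ᵍ-coprime⟩ b^n≈ε v⊥n)

        module Decomposition (m⊥n : Coprime m n) where
          d = gcd t m
          d∣m = gcd[m,n]∣n t m
          d∣t = gcd[m,n]∣m t m
          q = quotient d∣m
          m≡q*d : m ≡ q * d
          m≡q*d = m∣n⇒n≡quotient*m d∣m
          m≡d*q : m ≡ d * q
          m≡d*q = ≡.trans m≡q*d (*-comm q d)
          instance
            d≢0 : NonZero d
            d≢0 = ≢-nonZero (λ d≡0 → ≢-nonZero⁻¹ m (gcd[m,n]≡0⇒n≡0 t d≡0))
            q≢0 : NonZero q
            q≢0 = m*n≢0⇒m≢0 q {{≡.subst NonZero m≡q*d m≢0}}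

          m∣t*S : m ∣ t * geomSum (suc t) n
          m∣t*S = ≡.subst (λ z → m ∣ t * z)
            (≡.trans (*-identityˡ _) (cong (λ s → geomSum s n) (≡.trans (^-identityʳ r) r≡1+t)))
            (m∣t*[u*S] 1 (Coprimality.1-coprimeTo n))

          d⊥q : Coprime d q
          d⊥q = gcd-cofactor-coprime {t = t} m⊥n m∣t*S

          a^[i*x*y]≈ε : ∀ {x y} → m ≡ x * y → ∀ i → a ^ᵍ (i * x * y) ≈ ε
          a^[i*x*y]≈ε {x} {y} m≡x*y i = ^ᵍ-∣ a^m≈ε (divides i (≡.trans (*-assoc i x y) (cong (i *_) (≡.sym m≡x*y))))

          H = ⟨b^ 1 ⟩⟨a^ d ⟩
          K = ⟨b^ n ⟩⟨a^ q ⟩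

          K-central : ∀ {k} g → K k → Commute k g
          K-central g (lift (v , _ , n∣v , divides j refl , k≈)) with v′ , u′ , g≈ ← normalForm g =
            commute-respˡ (sym k≈a^[j*q]) (commute-respʳ (sym g≈)
              (commuteʳ-∙ (commuteʳ-^ᵍ v′ (m∣t*⇒commute-b (j * q) m∣t*[j*q])) (^ᵍ-comm a (j * q) u′)))
            where
            k≈a^[j*q] = trans k≈ (trans (∙-congʳ (^ᵍ-∣ b^n≈ε n∣v)) (identityˡ _))
            m∣t*[j*q] : m ∣ t * (j * q)
            m∣t*[j*q] = divides (quotient d∣t * j) (≡.trans (cong (_* (j * q)) (m∣n⇒n≡quotient*m d∣t))
              (≡.trans (rearrange (quotient d∣t) d j q) (cong (quotient d∣t * j *_) (≡.sym m≡q*d))))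
              where
              rearrange : ∀ s d j q → s * d * (j * q) ≡ s * j * (q * d)
              rearrange = solve-∀

          H∩K≈ε : ∀ x → H x → K x → x ≈ ε
          H∩K≈ε x (lift (v , _ , _ , divides j refl , x≈)) (lift (v′ , _ , n∣v′ , divides j′ refl , x≈′))
            with b^v≈b^v′ , z≈a^[j′*q] ← ⟨b⟩⟨a⟩-factorisation-unique
                   (^ᵍ∈⟨⟩ b v) (^ᵍ∈⟨⟩ b v′) (^ᵍ∈⟨⟩ a (j * d)) (^ᵍ∈⟨⟩ a (j′ * q)) (trans (sym x≈) x≈′) =
            trans x≈ (trans (∙-cong (trans b^v≈b^v′ (^ᵍ-∣ b^n≈ε n∣v′)) z≈ε) (identityˡ ε))
            where
            z≈ε : a ^ᵍ (j * d) ≈ ε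
            z≈ε = ^ᵍ-coprime⇒≈ε {y = q}
              (trans (^ᵍ-congˡ d z≈a^[j′*q]) (trans (^ᵍ-assoc a (j′ * q) d) (a^[i*x*y]≈ε m≡q*d j′)))
              (trans (^ᵍ-assoc a (j * d) q) (a^[i*x*y]≈ε m≡d*q j))
              d⊥q

          G≈HK : ∀ g → ∃ λ h → ∃ λ k → H h × K k × g ≈ h ∙ k
          G≈HK g with v , u , g≈ ← normalForm g
            with A , B , d∣A , q∣B , j , A+B≡ ← coprime⇒split d⊥q u =
            b ^ᵍ v ∙ a ^ᵍ A , a ^ᵍ B ,
            lift (v , A , 1∣ v , d∣A , ≈-refl) , lift (0 , B , n ∣0 , q∣B , sym (identityˡ _)) , (begin
              g                                  ≈⟨ g≈ ⟩
              b ^ᵍ v ∙ a ^ᵍ u                    ≈⟨ ∙-congˡ (identityʳ _) ⟨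
              b ^ᵍ v ∙ (a ^ᵍ u ∙ ε)              ≈⟨ ∙-congˡ (∙-congˡ a^[j*[d*q]]≈ε) ⟨
              b ^ᵍ v ∙ (a ^ᵍ u ∙ a ^ᵍ (j * (d * q)))  ≈⟨ ∙-congˡ (^ᵍ-homo-+ a u _) ⟨
              b ^ᵍ v ∙ a ^ᵍ (u + j * (d * q))    ≈⟨ ∙-congˡ (^ᵍ-congʳ a A+B≡) ⟨
              b ^ᵍ v ∙ a ^ᵍ (A + B)              ≈⟨ ∙-congˡ (^ᵍ-homo-+ a A B) ⟩
              b ^ᵍ v ∙ (a ^ᵍ A ∙ a ^ᵍ B)         ≈⟨ assoc _ _ _ ⟨
              (b ^ᵍ v ∙ a ^ᵍ A) ∙ a ^ᵍ B         ∎)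
            where
            a^[j*[d*q]]≈ε : a ^ᵍ (j * (d * q)) ≈ ε
            a^[j*[d*q]]≈ε = ^ᵍ-∣ a^m≈ε (divides j (cong (j *_) (≡.sym m≡d*q)))

          gcd[t,m]≢1⇒directProduct : ¬ n ≡ 1 → ¬ d ≡ 1 → IsDirectProductOfNontrivial
          gcd[t,m]≢1⇒directProduct n≢1 d≢1 = central-complement⇒directProduct
            (⟨b^⟩⟨a^⟩-isSubgroup 1 d) (⟨b^⟩⟨a^⟩-isSubgroup n q) K-central H∩K≈ε G≈HK
            (b , lift (1 , 0 , 1∣ 1 , d ∣0 , sym (trans (identityʳ _) (identityʳ b))) ,
                 λ b≈ε → n≢1 (∣1⇒≡1 (hasOrder⇒∣ b-order (trans (identityʳ b) b≈ε))))
            (a ^ᵍ q , lift (0 , q , n ∣0 , ∣-refl , sym (identityˡ _)) ,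
                 proj₁ (hasOrder-cofactor q a-order m≡q*d (≤∧≢⇒< (>-nonZero⁻¹ d) (d≢1 ∘ ≡.sym))))

        ¬directProduct⇒coprime : Coprime m n → ¬ n ≡ 1 → ¬ IsDirectProductOfNontrivial → Coprime t m
        ¬directProduct⇒coprime m⊥n n≢1 ¬directProduct with gcd t m ≟ 1
        ... | yes gcd[t,m]≡1 = gcd≡1⇒coprime gcd[t,m]≡1
        ... | no  gcd[t,m]≢1 =
          ⊥-elim (¬directProduct (Decomposition.gcd[t,m]≢1⇒directProduct m⊥n n≢1 gcd[t,m]≢1))

        a^i∙b^j-order : Coprime t m → ∀ i {j} → Coprime j n → HasOrder (a ^ᵍ i ∙ b ^ᵍ j) n
        a^i∙b^j-order t⊥m i {j} j⊥n = ∣⇒hasOrder (proj₁ b-order) [aⁱbʲ]^n≈ε n∣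
          where
          u = i * r ^ j
          aⁱbʲ = a ^ᵍ i ∙ b ^ᵍ j
          [aⁱbʲ]^k≈ : ∀ k → aⁱbʲ ^ᵍ k ≈ b ^ᵍ (j * k) ∙ a ^ᵍ (u * geomSum (r ^ j) k)
          [aⁱbʲ]^k≈ k = trans (^ᵍ-congˡ k (a^u∙b^v≈b^v∙a^[u*r^v] i j)) ([b^v∙a^u]^k j u k)
          [aⁱbʲ]^n≈ε : aⁱbʲ ^ᵍ n ≈ ε
          [aⁱbʲ]^n≈ε = trans (^ᵍ-congˡ n (a^u∙b^v≈b^v∙a^[u*r^v] i j))
            (trans ([b^v∙a^u]^n≈a^[u*S] j u) (^ᵍ-∣ a^m≈ε (coprime-divisor (Coprimality.sym t⊥m) (m∣t*[u*S] u j⊥n))))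
          n∣ : ∀ k → aⁱbʲ ^ᵍ k ≈ ε → n ∣ k
          n∣ k [aⁱbʲ]^k≈ε = coprime-divisor (Coprimality.sym j⊥n) (hasOrder⇒∣ b-order (proj₁
            (⟨b⟩⟨a⟩-factorisation-unique
              (^ᵍ∈⟨⟩ b (j * k)) (^ᵍ∈⟨⟩ b 0) (^ᵍ∈⟨⟩ a (u * geomSum (r ^ j) k)) (^ᵍ∈⟨⟩ a 0)
              (trans (sym ([aⁱbʲ]^k≈ k)) (trans [aⁱbʲ]^k≈ε (sym (identityˡ ε)))))))

lemma4p1 : ∀ {c ℓ} (G : Group c ℓ) (m n r : ℕ) .{{_ : NonZero m}} (a b : Group.Carrier G) →
    let open Group G in let open GroupTheory G in
    HasOrder a m → HasOrder b n → HasOrderG (m * n) →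
    (∀ g → ∃ λ i → ∃ λ j → g ≈ (a ^ᵍ i) ∙ (b ^ᵍ j)) →
    (b ⁻¹ ∙ a) ∙ b ≈ a ^ᵍ r →
    (r ^ n) % m ≡ 1 % m →
    ¬ IsAbelian →
    AllSylowCyclic (m * n) →
    ¬ IsDirectProductOfNontrivial →
    ∀ i j → i ≤ m → gcd j n ≡ 1 →
    HasOrder ((a ^ᵍ i) ∙ (b ^ᵍ j)) n × HasOrder (b ^ᵍ j) n
lemma4p1 G m n r a b a-order b-order |G|≡mn G≈⟨a⟩⟨b⟩ b⁻¹ab≈a^r _ nonabelian sylow-cyclic ¬directProduct i j _ gcd[j,n]≡1 =
  a^i∙b^j-order t⊥m i j⊥n , hasOrder-^ᵍ-coprime b-order j⊥n
  where
  open Properties G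
  open Metacyclic G
  open Conjugation {r} b⁻¹ab≈a^r
  open Finite a-order b-order |G|≡mn G≈⟨a⟩⟨b⟩
  j⊥n : Coprime j n
  j⊥n = gcd≡1⇒coprime gcd[j,n]≡1
  instance
    r≢0 : NonZero r
    r≢0 = ≢-nonZero (nonabelian ∘ m≡1⇒abelian ∘ r≡0⇒m≡1)
  open Centraliser (≡.sym (suc-pred r))
  t⊥m : Coprime (pred r) m
  t⊥m = ¬directProduct⇒coprime (sylow-cyclic⇒coprime sylow-cyclic) (nonabelian ∘ n≡1⇒abelian) ¬directProduct
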